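{- Let $m\geq 3$ and let $A$ be the regular complete bipartite graph of order $m$, i.e. $A=K_{m,m}$ (both parts of size $m$). Let $S(A)$ be the subdivision of $A$. Then $S(A)$ is $\lambda$-EQDB if and only if $\lambda=\frac{m^2-1}{2m-1}$.
   Context: The subdivision $S(A)$ of a connected graph $A$ is obtained by inserting one new vertex into each edge of $A$, i.e. replacing each edge by a path of length $2$. For a connected graph $G$, $d_G$ is shortest-path distance; for a vertex $x$ and an edge $f'=g'h'$, $d_G(x,f')=\min\{d_G(x,g'),d_G(x,h')\}$. For an edge $f=gh$, $m_g(f)=|\{f'\in E(G): d_G(g,f')<d_G(h,f')\}|$, and $m_h(f)$ symmetrically. For $\lambda>1$, $G$ is $\lambda$-EQDB if for every edge $f=gh$ either $m_g(f)=\lambda m_h(f)$ or $m_h(f)=\lambda m_g(f)$.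
   Formalization: The parameter λ ranges over the rationals greater than 1. -}

module Defs where

open import Data.Nat using (ℕ; zero; suc; _+_; _∸_)
open import Data.Fin using (Fin; _↑ˡ_; _↑ʳ_) renaming (_≟_ to _≟ᶠ_)
open import Data.Bool using (Bool; true; false; _∧_; _∨_; if_then_else_)
open import Data.List using (List; []; _∷_; map; concatMap; length; filter; lookup; allFin)
open import Data.Bool.ListAction using (any)
open import Data.List.Membership.Propositional using (_∈_)
open import Data.Product using (_×_; _,_; proj₁; proj₂)
open import Data.Sum using (_⊎_)
open import Data.Integer using (+_)
open import Data.Rational using (ℚ; _/_) renaming (_*_ to _*ℚ_)
open import Relation.Nullary.Decidable using (⌊_⌋)
open import Relation.Binary.PropositionalEquality using (_≡_)

-- A (multi)graph on vertex set Fin n, given by its list of edges.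
-- An edge (g , h) is the (undirected) edge gh.
record Graph : Set where
  field
    n     : ℕ
    edges : List (Fin n × Fin n)
open Graph public

adj : (G : Graph) → Fin (n G) → Fin (n G) → Bool
adj G x y = any (λ e → (⌊ proj₁ e ≟ᶠ x ⌋ ∧ ⌊ proj₂ e ≟ᶠ y ⌋)
                     ∨ (⌊ proj₁ e ≟ᶠ y ⌋ ∧ ⌊ proj₂ e ≟ᶠ x ⌋)) (edges G)

within : (G : Graph) → ℕ → Fin (n G) → Fin (n G) → Bool
within G zero    x y = ⌊ x ≟ᶠ y ⌋
within G (suc k) x y = within G k x y ∨ any (λ z → adj G x z ∧ within G k z y) (allFin (n G))

search : (G : Graph) → Fin (n G) → Fin (n G) → (fuel start : ℕ) → ℕ
search G x y zero       k = k
search G x y (suc fuel) k = if within G k x y then k else search G x y fuel (suc k)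

-- shortest-path distance d_G(x,y) (exact for connected graphs, where it is < n)
dist : (G : Graph) → Fin (n G) → Fin (n G) → ℕ
dist G x y = search G x y (n G) 0

distE : (G : Graph) → Fin (n G) → Fin (n G) × Fin (n G) → ℕ
distE G x (g' , h') = Data.Nat._⊓_ (dist G x g') (dist G x h')

mcount : (G : Graph) → (g h : Fin (n G)) → ℕ
mcount G g h = length (filter (λ f' → Data.Nat._<?_ (distE G g f') (distE G h f')) (edges G))

toℚ : ℕ → ℚ
toℚ a = (+ a) / 1

-- G is λ-EQDB (λ > 1 is a separate hypothesis in the statement)
IsEQDB : ℚ → Graph → Set
IsEQDB λ' G = ∀ {g h} → (g , h) ∈ edges G →
  (toℚ (mcount G g h) ≡ λ' *ℚ toℚ (mcount G h g)) ⊎ (toℚ (mcount G h g) ≡ λ' *ℚ toℚ (mcount G g h))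

-- Subdivision S(A): vertices Fin (n + |E|); the k-th edge uv of A is replaced
-- by the path u – (n+k) – v.
subdivision : Graph → Graph
subdivision A = record
  { n = n A + length (edges A)
  ; edges = concatMap
      (λ k → let e = lookup (edges A) k in
        (proj₁ e ↑ˡ _ , n A ↑ʳ k) ∷ (proj₂ e ↑ˡ _ , n A ↑ʳ k) ∷ [])
      (allFin (length (edges A)))
  }

-- K_{m,m}: parts {0..m-1} and {m..2m-1}, every cross pair is an edge (once).
Kmm : ℕ → Graph
Kmm m = record
  { n = m + m
  ; edges = concatMap (λ i → map (λ j → (i ↑ˡ m , m ↑ʳ j)) (allFin m)) (allFin m)
  }

{-# OPTIONS --safe #-}
-- Fix an edge e₀ = a₀b₀ of K_{m,m} and let x₀ be its subdivision vertex. In S(K_{m,m}) the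
-- distance from a₀, b₀ or x₀ to a vertex v depends only on whether v is one of a₀, b₀, x₀ or
-- shares an endpoint with them, so it is given by a small table. A table is the true distance as
-- soon as it is 1-Lipschitz along edges, vanishes at the source and is realised by walks.
-- Counting the edges of S(K_{m,m}) closer to one end of the edge a₀x₀ than to the other then
-- gives m² - 1 and 2m - 1, for every edge. Since 2m - 1 < m² - 1 and λ > 1, the λ-EQDB
-- condition holds exactly for λ = (m² - 1)/(2m - 1).
module Submission where

open import Defs
open import Data.Nat using (ℕ; suc; _*_; _∸_; _≥_)
open import Data.Integer using (+_)
open import Data.Rational using (ℚ; _/_; _<_; 1ℚ)
open import Function.Bundles using (_⇔_)
open import Relation.Binary.PropositionalEquality using (_≡_)

open import Data.Bool using (Bool; true; false; T; _∧_; _∨_; if_then_else_)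
open import Data.Bool.Properties using (T-∧; T-∨)
open import Data.Empty using (⊥-elim)
open import Data.Fin as Fin using (Fin; _↑ˡ_; _↑ʳ_; splitAt; punchIn) renaming (_≟_ to _≟ᶠ_)
open import Data.Fin.Properties using (punchInᵢ≢i; splitAt-↑ˡ; splitAt-↑ʳ; splitAt⁻¹-↑ˡ; splitAt⁻¹-↑ʳ)
import Data.Integer as ℤ
import Data.Integer.Properties as ℤ
import Data.Integer.Tactic.RingSolver as ℤ-Solver
open import Data.List using (List; []; _∷_; _++_; map; concatMap; length; lookup; filter; tabulate; allFin)
open import Data.List.Properties using (map-++; map-∘; map-tabulate)
open import Data.List.Membership.Propositional using (_∈_; lose)
open import Data.List.Membership.Propositional.Properties
  using (∈-allFin; ∈-lookup; ∈-map⁺; ∈-map⁻; ∈-concatMap⁺; ∈-concatMap⁻)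
open import Data.List.Relation.Unary.Any as Any using (here; there)
open import Data.List.Relation.Unary.Any.Properties using (any⁺; any⁻; Any-⊎⁻; lookup-index)
open import Data.Nat as ℕ using (zero; _+_; _≤_; _⊓_; _≤ᵇ_; _<ᵇ_; z≤n; s≤s)
open import Data.Nat.ListAction using (sum)
open import Data.Nat.ListAction.Properties using (sum-++)
open import Data.Nat.Properties
  using (≤-refl; ≤-trans; ≤-antisym; ≤∧≢⇒<; ≤ᵇ⇒≤; m≤n⇒m≤1+n; m≤m+n; m≤n⇒m≤n+o; +-monoʳ-≤; +-mono-≤;
         +-suc; +-identityʳ; suc-injective; +-0-commutativeMonoid; module ≤-Reasoning)
open import Algebra.Properties.CommutativeMonoid.Sum +-0-commutativeMonoid using (sum-syntax; sum-cong-≗; sum-remove)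
open import Data.Nat.Tactic.RingSolver using (solve-∀)
open import Data.Product using (_×_; _,_; proj₁; proj₂; ∃-syntax; ∃₂)
import Data.Product as Product
open import Data.Rational using (Positive; toℚᵘ) renaming (_*_ to _*ℚ_)
import Data.Rational.Properties as ℚ
open import Data.Rational.Unnormalised as ℚᵘ using (mkℚᵘ; *≡*; *<*)
import Data.Rational.Unnormalised.Properties as ℚᵘ
open import Data.Sum using (_⊎_; inj₁; inj₂; [_,_]′)
import Data.Sum as Sum
open import Function using (_∘_; id)
open import Function.Bundles using (Equivalence; mk⇔)
open import Relation.Nullary.Decidable using (⌊_⌋; does; yes; no; dec-true; dec-false; fromWitness; toWitness)
open import Relation.Unary using (Decidable)
open import Relation.Binary.PropositionalEquality
  using (refl; sym; trans; cong; cong₂; subst; subst₂; _≢_; module ≡-Reasoning)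

open Equivalence using (to; from)

infix 4 _==_
_==_ : ∀ {n} → Fin n → Fin n → Bool
i == j = does (i ≟ᶠ j)

==-refl : ∀ {n} (i : Fin n) → (i == i) ≡ true
==-refl i = dec-true (i ≟ᶠ i) refl

∑-const : ∀ n x → ∑[ i < n ] x ≡ n * x
∑-const zero    x = refl
∑-const (suc n) x = cong (_+_ x) (∑-const n x)

∑-flagged : ∀ {n} (f : Fin (suc n) → Bool → ℕ) (k₀ : Fin (suc n)) →
  ∑[ k < suc n ] f k (k == k₀) ≡ f k₀ true + ∑[ j < n ] f (punchIn k₀ j) false
∑-flagged f k₀ = trans (sum-remove {i = k₀} (λ k → f k (k == k₀)))
  (cong₂ _+_ (cong (f k₀) (==-refl k₀))
             (sum-cong-≗ (λ j → cong (f (punchIn k₀ j)) (dec-false (punchIn k₀ j ≟ᶠ k₀) (punchInᵢ≢i k₀ j)))))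

∑-unflag : ∀ {n} (f : Fin n → Bool → ℕ) (k₀ : Fin n) →
  f k₀ false + ∑[ k < n ] f k (k == k₀) ≡ f k₀ true + ∑[ k < n ] f k false
∑-unflag {suc n} f k₀ = begin
  f k₀ false + ∑[ k < suc n ] f k (k == k₀) ≡⟨ cong (_+_ (f k₀ false)) (∑-flagged f k₀) ⟩
  f k₀ false + (f k₀ true + rest)           ≡⟨ swap (f k₀ false) (f k₀ true) rest ⟩
  f k₀ true + (f k₀ false + rest)           ≡⟨ cong (_+_ (f k₀ true)) (sum-remove {i = k₀} (λ k → f k false)) ⟨
  f k₀ true + ∑[ k < suc n ] f k false      ∎
  where
  open ≡-Reasoning
  rest : ℕ
  rest = ∑[ j < n ] f (punchIn k₀ j) false
  swap : ∀ x y z → x + (y + z) ≡ y + (x + z)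
  swap = solve-∀

∑-indicator : ∀ {n} (f : Bool → ℕ) (i₀ : Fin (suc n)) → ∑[ i < suc n ] f (i == i₀) ≡ f true + n * f false
∑-indicator {n} f i₀ = trans (∑-flagged (λ _ → f) i₀) (cong (_+_ (f true)) (∑-const n (f false)))

gridSum : ℕ → (Bool → Bool → ℕ) → ℕ
gridSum n f = (f true true + n * f true false) + n * (f false true + n * f false false)

∑-grid : ∀ {n} (f : Bool → Bool → ℕ) (a₀ b₀ : Fin (suc n)) →
  ∑[ a < suc n ] ∑[ b < suc n ] f (a == a₀) (b == b₀) ≡ gridSum n f
∑-grid {n} f a₀ b₀ = trans (sum-cong-≗ (λ a → ∑-indicator (f (a == a₀)) b₀))
                           (∑-indicator (λ α → f α true + n * f α false) a₀)

∑-lookup : ∀ {A : Set} (f : A → ℕ) xs → ∑[ i < length xs ] f (lookup xs i) ≡ sum (map f xs)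
∑-lookup f []       = refl
∑-lookup f (x ∷ xs) = cong (_+_ (f x)) (∑-lookup f xs)

sum-tabulate : ∀ n (f : Fin n → ℕ) → sum (tabulate f) ≡ ∑[ i < n ] f i
sum-tabulate zero    f = refl
sum-tabulate (suc n) f = cong (_+_ (f Fin.zero)) (sum-tabulate n (f ∘ Fin.suc))

sum-map-allFin : ∀ n (f : Fin n → ℕ) → sum (map f (allFin n)) ≡ ∑[ i < n ] f i
sum-map-allFin n f = trans (cong sum (map-tabulate id f)) (sum-tabulate n f)

sum-map-concatMap : ∀ {A B : Set} (f : B → ℕ) (g : A → List B) xs →
  sum (map f (concatMap g xs)) ≡ sum (map (sum ∘ map f ∘ g) xs)
sum-map-concatMap f g []       = refl
sum-map-concatMap f g (x ∷ xs) = begin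
  sum (map f (g x ++ concatMap g xs))                ≡⟨ cong sum (map-++ f (g x) _) ⟩
  sum (map f (g x) ++ map f (concatMap g xs))        ≡⟨ sum-++ (map f (g x)) _ ⟩
  sum (map f (g x)) + sum (map f (concatMap g xs))   ≡⟨ cong (_+_ (sum (map f (g x)))) (sum-map-concatMap f g xs) ⟩
  sum (map f (g x)) + sum (map (sum ∘ map f ∘ g) xs) ∎
  where open ≡-Reasoning

bit : Bool → ℕ
bit b = if b then 1 else 0

length-filter≡sum : ∀ {A : Set} {P : A → Set} (P? : Decidable P) xs →
  length (filter P? xs) ≡ sum (map (bit ∘ does ∘ P?) xs)
length-filter≡sum P? []       = refl
length-filter≡sum P? (x ∷ xs) with does (P? x)
... | true  = cong suc (length-filter≡sum P? xs)
... | false = length-filter≡sum P? xs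

Close : ℕ → ℕ → Set
Close a b = a ≤ suc b × b ≤ suc a

close-by-computation : ∀ {a b} → {T (a ≤ᵇ suc b)} → {T (b ≤ᵇ suc a)} → Close a b
close-by-computation {a} {b} {p} {q} = ≤ᵇ⇒≤ a (suc b) p , ≤ᵇ⇒≤ b (suc a) q

≤-by-computation : ∀ {a b} → {T (a ≤ᵇ b)} → a ≤ b
≤-by-computation {a} {b} {p} = ≤ᵇ⇒≤ a b p

private
  ≟-refl : ∀ {m} (i : Fin m) → T ⌊ i ≟ᶠ i ⌋
  ≟-refl i = fromWitness {a? = i ≟ᶠ i} refl

  adj-test⇔ : ∀ {m} (u v x y : Fin m) →
    T ((⌊ u ≟ᶠ x ⌋ ∧ ⌊ v ≟ᶠ y ⌋) ∨ (⌊ u ≟ᶠ y ⌋ ∧ ⌊ v ≟ᶠ x ⌋)) ⇔ ((x , y) ≡ (u , v) ⊎ (y , x) ≡ (u , v))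
  adj-test⇔ u v x y = mk⇔ sound complete
    where
    sound : T ((⌊ u ≟ᶠ x ⌋ ∧ ⌊ v ≟ᶠ y ⌋) ∨ (⌊ u ≟ᶠ y ⌋ ∧ ⌊ v ≟ᶠ x ⌋)) → (x , y) ≡ (u , v) ⊎ (y , x) ≡ (u , v)
    sound t with u ≟ᶠ x | v ≟ᶠ y | u ≟ᶠ y | v ≟ᶠ x
    ... | yes refl | yes refl | _        | _        = inj₁ refl
    ... | _        | _        | yes refl | yes refl = inj₂ refl
    sound () | no _  | _    | no _  | _
    sound () | no _  | _    | yes _ | no _
    sound () | yes _ | no _ | no _  | _
    sound () | yes _ | no _ | yes _ | no _
    complete : (x , y) ≡ (u , v) ⊎ (y , x) ≡ (u , v) → T ((⌊ u ≟ᶠ x ⌋ ∧ ⌊ v ≟ᶠ y ⌋) ∨ (⌊ u ≟ᶠ y ⌋ ∧ ⌊ v ≟ᶠ x ⌋))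
    complete (inj₁ refl) = from (T-∨ {⌊ u ≟ᶠ u ⌋ ∧ ⌊ v ≟ᶠ v ⌋}) (inj₁ (from (T-∧ {⌊ u ≟ᶠ u ⌋}) (≟-refl u , ≟-refl v)))
    complete (inj₂ refl) = from (T-∨ {⌊ u ≟ᶠ v ⌋ ∧ ⌊ v ≟ᶠ u ⌋}) (inj₂ (from (T-∧ {⌊ u ≟ᶠ u ⌋}) (≟-refl u , ≟-refl v)))

module _ (G : Graph) where

  Vertex : Set
  Vertex = Fin (n G)

  Adjacent : Vertex → Vertex → Set
  Adjacent x y = (x , y) ∈ edges G ⊎ (y , x) ∈ edges G

  infixr 5 _∷_
  data Walk : ℕ → Vertex → Vertex → Set where
    []  : ∀ {x} → Walk 0 x x
    _∷_ : ∀ {k x y z} → Adjacent x y → Walk k y z → Walk (suc k) x z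

  Lipschitz : (Vertex → ℕ) → Set
  Lipschitz D = ∀ {x y} → (x , y) ∈ edges G → Close (D x) (D y)

  adj-complete : ∀ {x y} → Adjacent x y → T (adj G x y)
  adj-complete {x} {y} (inj₁ xy∈) = any⁺ _ (Any.map (λ { refl → from (adj-test⇔ x y x y) (inj₁ refl) }) xy∈)
  adj-complete {x} {y} (inj₂ yx∈) = any⁺ _ (Any.map (λ { refl → from (adj-test⇔ y x x y) (inj₂ refl) }) yx∈)

  adj-sound : ∀ {x y} → T (adj G x y) → Adjacent x y
  adj-sound {x} {y} t = Any-⊎⁻ (Any.map (λ { {u , v} → to (adj-test⇔ u v x y) }) (any⁻ _ (edges G) t))

  walk⇒within : ∀ {k x y} → Walk k x y → T (within G k x y)
  walk⇒within {x = x} [] = ≟-refl x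
  walk⇒within (_∷_ {k} {x} {y} {z} xy w) = from (T-∨ {within G k x z})
    (inj₂ (any⁺ _ (lose (∈-allFin y) (from (T-∧ {adj G x y}) (adj-complete xy , walk⇒within w)))))

  within-suc⁻ : ∀ {k x y} → T (within G (suc k) x y) →
                T (within G k x y) ⊎ ∃[ z ] Adjacent x z × T (within G k z y)
  within-suc⁻ {k} {x} {y} t with to (T-∨ {within G k x y}) t
  ... | inj₁ t′ = inj₁ t′
  ... | inj₂ t′ with Any.satisfied (any⁻ _ (allFin (n G)) t′)
  ...   | z , t″ = inj₂ (z , Product.map adj-sound id (to (T-∧ {adj G x z}) t″))

  Lipschitz-step : ∀ {D} → Lipschitz D → ∀ {x y} → Adjacent x y → D y ≤ suc (D x)
  Lipschitz-step lip (inj₁ xy∈) = proj₂ (lip xy∈)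
  Lipschitz-step lip (inj₂ yx∈) = proj₁ (lip yx∈)

  within⇒≤ : ∀ {D} → Lipschitz D → ∀ k {x y} → T (within G k x y) → D y ≤ k + D x
  within⇒≤ lip zero {x} {y} t rewrite toWitness {a? = x ≟ᶠ y} t = ≤-refl
  within⇒≤ {D} lip (suc k) {x} {y} t with within-suc⁻ {k} t
  ... | inj₁ t′ = m≤n⇒m≤1+n (within⇒≤ lip k t′)
  ... | inj₂ (z , xz , zy) = begin
    D y           ≤⟨ within⇒≤ lip k zy ⟩
    k + D z       ≤⟨ +-monoʳ-≤ k (Lipschitz-step lip xz) ⟩
    k + suc (D x) ≡⟨ +-suc k (D x) ⟩
    suc k + D x   ∎
    where open ≤-Reasoning

  search-least : ∀ {x y d} → T (within G d x y) → (∀ {i} → T (within G i x y) → d ≤ i) →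
                 ∀ fuel k → k ≤ d → d ≤ k + fuel → search G x y fuel k ≡ d
  search-least reach least zero       k k≤d d≤k = ≤-antisym k≤d (subst (_ ≤_) (+-identityʳ k) d≤k)
  search-least {x} {y} {d} reach least (suc fuel) k k≤d d≤k+1+fuel with within G k x y in eq
  ... | true  = ≤-antisym k≤d (least (subst T (sym eq) _))
  ... | false = search-least reach least fuel (suc k) (≤∧≢⇒< k≤d k≢d) (subst (d ≤_) (+-suc k fuel) d≤k+1+fuel)
    where
    k≢d : k ≢ d
    k≢d refl = subst T eq reach

  dist-from-potential : ∀ {D s} → Lipschitz D → D s ≡ 0 →
                        ∀ {y} → D y ≤ n G → Walk (D y) s y → dist G s y ≡ D y
  dist-from-potential {D} {s} lip Ds≡0 {y} D≤n w = search-least (walk⇒within w) least (n G) 0 z≤n D≤n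
    where
    least : ∀ {i} → T (within G i s y) → D y ≤ i
    least {i} t = subst (D y ≤_) (trans (cong (_+_ i) Ds≡0) (+-identityʳ i)) (within⇒≤ lip i t)

  closerTo : Vertex → Vertex → Vertex × Vertex → ℕ
  closerTo g h f′ = bit (distE G g f′ <ᵇ distE G h f′)

  mcount≡∑closerTo : ∀ g h → mcount G g h ≡ sum (map (closerTo g h) (edges G))
  mcount≡∑closerTo g h = length-filter≡sum _ (edges G)

Adjacent-sym : ∀ {G x y} → Adjacent G x y → Adjacent G y x
Adjacent-sym = Sum.swap

infixr 5 _++ʷ_
_++ʷ_ : ∀ {G k l x y z} → Walk G k x y → Walk G l y z → Walk G (k + l) x z
[]      ++ʷ w = w
(a ∷ v) ++ʷ w = a ∷ (v ++ʷ w)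

toℚ-suc-pos : ∀ a → Positive (toℚ (suc a))
toℚ-suc-pos a = ℚ.normalize-pos (suc a) 1

toℚ≡ratio*toℚ : ∀ a d → toℚ a ≡ ((+ a) / suc d) *ℚ toℚ (suc d)
toℚ≡ratio*toℚ a d = ℚ.toℚᵘ-injective (begin-equality
  toℚᵘ (toℚ a)                                  ≃⟨ ℚ.toℚᵘ-fromℚᵘ (mkℚᵘ (+ a) 0) ⟩
  mkℚᵘ (+ a) 0                                  ≃⟨ *≡* (cancel (+ a) (+ suc d)) ⟩
  mkℚᵘ (+ a) d ℚᵘ.* mkℚᵘ (+ suc d) 0            ≃⟨ ℚᵘ.*-cong (ℚ.toℚᵘ-fromℚᵘ (mkℚᵘ (+ a) d))
                                                              (ℚ.toℚᵘ-fromℚᵘ (mkℚᵘ (+ suc d) 0)) ⟨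
  toℚᵘ ((+ a) / suc d) ℚᵘ.* toℚᵘ (toℚ (suc d))  ≃⟨ ℚ.toℚᵘ-homo-* ((+ a) / suc d) (toℚ (suc d)) ⟨
  toℚᵘ (((+ a) / suc d) *ℚ toℚ (suc d))         ∎)
  where
  open ℚᵘ.≤-Reasoning
  cancel : ∀ a D → a ℤ.* (D ℤ.* + 1) ≡ (a ℤ.* D) ℤ.* + 1
  cancel = ℤ-Solver.solve-∀

*-cancelʳ-≡-pos : ∀ {p q} r .{{_ : Positive r}} → p *ℚ r ≡ q *ℚ r → p ≡ q
*-cancelʳ-≡-pos r eq =
  ℚ.≤-antisym (ℚ.*-cancelʳ-≤-pos r (ℚ.≤-reflexive eq)) (ℚ.*-cancelʳ-≤-pos r (ℚ.≤-reflexive (sym eq)))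

toℚ-mono-< : ∀ {a b} → a ℕ.< b → toℚ a < toℚ b
toℚ-mono-< {a} {b} a<b = ℚ.toℚᵘ-cancel-<
  (ℚᵘ.<-respˡ-≃ (ℚᵘ.≃-sym (ℚ.toℚᵘ-fromℚᵘ (mkℚᵘ (+ a) 0)))
    (ℚᵘ.<-respʳ-≃ (ℚᵘ.≃-sym (ℚ.toℚᵘ-fromℚᵘ (mkℚᵘ (+ b) 0)))
      (*<* (subst₂ ℤ._<_ (sym (ℤ.*-identityʳ (+ a))) (sym (ℤ.*-identityʳ (+ b))) (ℤ.+<+ a<b)))))

λ≡ratio : ∀ a b {λ'} → toℚ a ≡ λ' *ℚ toℚ (suc b) → λ' ≡ (+ a) / suc b
λ≡ratio a b eq = *-cancelʳ-≡-pos (toℚ (suc b)) {{toℚ-suc-pos b}} (trans (sym eq) (toℚ≡ratio*toℚ a b))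

smaller≢λ*larger : ∀ a b {λ'} → 1ℚ < λ' → a ℕ.< suc b → toℚ a ≢ λ' *ℚ toℚ (suc b)
smaller≢λ*larger a b {λ'} 1<λ a<b eq = ℚ.<-irrefl eq (begin-strict
  toℚ a             <⟨ toℚ-mono-< a<b ⟩
  toℚ (suc b)       ≡⟨ ℚ.*-identityˡ (toℚ (suc b)) ⟨
  1ℚ *ℚ toℚ (suc b) <⟨ ℚ.*-monoˡ-<-pos (toℚ (suc b)) {{toℚ-suc-pos b}} 1<λ ⟩
  λ' *ℚ toℚ (suc b) ∎)
  where open ℚ.≤-Reasoning

IsEQDB⇔ratio : ∀ (G : Graph) a b {λ'} →
  (∀ {g h} → (g , h) ∈ edges G → mcount G g h ≡ a × mcount G h g ≡ suc b) →
  ∀ {g h} → (g , h) ∈ edges G → suc b ℕ.< a → 1ℚ < λ' → IsEQDB λ' G ⇔ (λ' ≡ (+ a) / suc b)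
IsEQDB⇔ratio G (suc a) b {λ'} counts {g} {h} gh∈ b<a 1<λ =
  mk⇔ (λ isEQDB → [ forward , backward ]′ (isEQDB gh∈)) eqdb
  where
  transport : ∀ {x y u v} → mcount G x y ≡ u → mcount G y x ≡ v →
              toℚ (mcount G x y) ≡ λ' *ℚ toℚ (mcount G y x) → toℚ u ≡ λ' *ℚ toℚ v
  transport = subst₂ (λ u v → toℚ u ≡ λ' *ℚ toℚ v)
  forward : toℚ (mcount G g h) ≡ λ' *ℚ toℚ (mcount G h g) → λ' ≡ (+ suc a) / suc b
  forward eq = λ≡ratio (suc a) b {λ'} (transport (proj₁ (counts gh∈)) (proj₂ (counts gh∈)) eq)
  backward : toℚ (mcount G h g) ≡ λ' *ℚ toℚ (mcount G g h) → λ' ≡ (+ suc a) / suc b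
  backward eq = ⊥-elim (smaller≢λ*larger (suc b) a {λ'} 1<λ b<a
                          (transport (proj₂ (counts gh∈)) (proj₁ (counts gh∈)) eq))
  eqdb : λ' ≡ (+ suc a) / suc b → IsEQDB λ' G
  eqdb refl e∈ = inj₁ (subst₂ (λ u v → toℚ u ≡ λ' *ℚ toℚ v) (sym (proj₁ (counts e∈))) (sym (proj₂ (counts e∈)))
                              (toℚ≡ratio*toℚ (suc a) b))

module Subdivision (A : Graph) where

  S : Graph
  S = subdivision A

  L : ℕ
  L = length (edges A)

  orig : Fin (n A) → Vertex S
  orig i = i ↑ˡ L

  mid : Fin L → Vertex S
  mid e = n A ↑ʳ e

  src tgt : Fin L → Fin (n A)
  src e = proj₁ (lookup (edges A) e)
  tgt e = proj₂ (lookup (edges A) e)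

  halves : Fin L → List (Vertex S × Vertex S)
  halves e = (orig (src e) , mid e) ∷ (orig (tgt e) , mid e) ∷ []

  src-half∈ : ∀ e → (orig (src e) , mid e) ∈ edges S
  src-half∈ e = ∈-concatMap⁺ halves (lose (∈-allFin e) (here refl))

  tgt-half∈ : ∀ e → (orig (tgt e) , mid e) ∈ edges S
  tgt-half∈ e = ∈-concatMap⁺ halves (lose (∈-allFin e) (there (here refl)))

  data Half : Vertex S → Vertex S → Set where
    src-half : ∀ e → Half (orig (src e)) (mid e)
    tgt-half : ∀ e → Half (orig (tgt e)) (mid e)

  half : ∀ {x y} → (x , y) ∈ edges S → Half x y
  half xy∈ with Any.satisfied (∈-concatMap⁻ halves {xs = allFin L} xy∈)
  ... | e , here refl         = src-half e
  ... | e , there (here refl) = tgt-half e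

  Lipschitz-subdivision : ∀ {D} →
    (∀ e → Close (D (orig (src e))) (D (mid e)) × Close (D (orig (tgt e))) (D (mid e))) → Lipschitz S D
  Lipschitz-subdivision close xy∈ with half xy∈
  ... | src-half e = proj₁ (close e)
  ... | tgt-half e = proj₂ (close e)

  mcount-subdivision : ∀ g h →
    mcount S g h ≡ ∑[ e < L ] (closerTo S g h (orig (src e) , mid e) + closerTo S g h (orig (tgt e) , mid e))
  mcount-subdivision g h = begin
    mcount S g h                                ≡⟨ mcount≡∑closerTo S g h ⟩
    sum (map c (concatMap halves (allFin L)))   ≡⟨ sum-map-concatMap c halves (allFin L) ⟩
    sum (map (sum ∘ map c ∘ halves) (allFin L)) ≡⟨ sum-map-allFin L (sum ∘ map c ∘ halves) ⟩
    ∑[ e < L ] sum (map c (halves e))           ≡⟨ sum-cong-≗ (λ e → cong (_+_ (c (orig (src e) , mid e))) (+-identityʳ _)) ⟩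
    ∑[ e < L ] (c (orig (src e) , mid e) + c (orig (tgt e) , mid e)) ∎
    where
    open ≡-Reasoning
    c : Vertex S × Vertex S → ℕ
    c = closerTo S g h

-- Distances from the vertex at place p of an edge e₀ = a₀b₀ of K_{m,m}: δ-left to a left vertex a
-- (α : a = a₀), δ-right to a right vertex b (β : b = b₀), δ-mid to the subdivision vertex of an
-- edge e = ab (τ : e = e₀, α : a = a₀, β : b = b₀).
data Place : Set where
  leftEnd rightEnd middle : Place

δ-left δ-right : Place → Bool → ℕ
δ-left leftEnd  true  = 0
δ-left leftEnd  false = 4
δ-left rightEnd _     = 2
δ-left middle   true  = 1
δ-left middle   false = 3
δ-right leftEnd  _     = 2
δ-right rightEnd true  = 0
δ-right rightEnd false = 4
δ-right middle   true  = 1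
δ-right middle   false = 3

δ-mid : Place → Bool → Bool → Bool → ℕ
δ-mid leftEnd  _     true  _     = 1
δ-mid leftEnd  _     false _     = 3
δ-mid rightEnd _     _     true  = 1
δ-mid rightEnd _     _     false = 3
δ-mid middle   true  _     _     = 0
δ-mid middle   false true  _     = 2
δ-mid middle   false false true  = 2
δ-mid middle   false false false = 4

δ-path : Place → Bool → Bool → Bool → ℕ × ℕ × ℕ
δ-path p τ α β = δ-left p α , δ-right p β , δ-mid p τ α β

closerHalves : ℕ × ℕ × ℕ → ℕ × ℕ × ℕ → ℕ
closerHalves (l , r , c) (l′ , r′ , c′) = bit (l ⊓ c <ᵇ l′ ⊓ c′) + bit (r ⊓ c <ᵇ r′ ⊓ c′)

δ-closerHalves : Place → Place → Bool → Bool → Bool → ℕ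
δ-closerHalves p q τ α β = closerHalves (δ-path p τ α β) (δ-path q τ α β)

δ-left≤4 : ∀ p α → δ-left p α ≤ 4
δ-left≤4 leftEnd  true  = ≤-by-computation
δ-left≤4 leftEnd  false = ≤-by-computation
δ-left≤4 rightEnd _     = ≤-by-computation
δ-left≤4 middle   true  = ≤-by-computation
δ-left≤4 middle   false = ≤-by-computation

δ-right≤4 : ∀ p β → δ-right p β ≤ 4
δ-right≤4 leftEnd  _     = ≤-by-computation
δ-right≤4 rightEnd true  = ≤-by-computation
δ-right≤4 rightEnd false = ≤-by-computation
δ-right≤4 middle   true  = ≤-by-computation
δ-right≤4 middle   false = ≤-by-computation

δ-mid≤4 : ∀ p τ α β → δ-mid p τ α β ≤ 4
δ-mid≤4 leftEnd  _     true  _     = ≤-by-computation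
δ-mid≤4 leftEnd  _     false _     = ≤-by-computation
δ-mid≤4 rightEnd _     _     true  = ≤-by-computation
δ-mid≤4 rightEnd _     _     false = ≤-by-computation
δ-mid≤4 middle   true  _     _     = ≤-by-computation
δ-mid≤4 middle   false true  _     = ≤-by-computation
δ-mid≤4 middle   false false true  = ≤-by-computation
δ-mid≤4 middle   false false false = ≤-by-computation

δ-close : ∀ p τ α β → (T τ → T (α ∧ β)) → Close (δ-left p α) (δ-mid p τ α β) × Close (δ-right p β) (δ-mid p τ α β)
δ-close leftEnd  _     true  _     _ = close-by-computation , close-by-computation
δ-close leftEnd  _     false _     _ = close-by-computation , close-by-computation
δ-close rightEnd _     _     true  _ = close-by-computation , close-by-computation
δ-close rightEnd _     _     false _ = close-by-computation , close-by-computation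
δ-close middle   true  true  true  _ = close-by-computation , close-by-computation
δ-close middle   true  false _     h = ⊥-elim (h _)
δ-close middle   true  true  false h = ⊥-elim (h _)
δ-close middle   false true  true  _ = close-by-computation , close-by-computation
δ-close middle   false true  false _ = close-by-computation , close-by-computation
δ-close middle   false false true  _ = close-by-computation , close-by-computation
δ-close middle   false false false _ = close-by-computation , close-by-computation

-- m = 2 + k: m ≥ 2 gives 4 ≤ n S, so the fuel of dist covers every distance, and in this form
-- m * m ∸ 1 and 2 * m ∸ 2 compute to polynomials in k.
module SubdividedKmm (k : ℕ) where

  m : ℕ
  m = 2 + k

  open Subdivision (Kmm m) public

  E : List (Fin (m + m) × Fin (m + m))
  E = edges (Kmm m)

  side-index : Fin (m + m) → Fin m
  side-index i = [ id , id ]′ (splitAt m i)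

  side-index-↑ˡ : ∀ a → side-index (a ↑ˡ m) ≡ a
  side-index-↑ˡ a rewrite splitAt-↑ˡ m a m = refl

  side-index-↑ʳ : ∀ b → side-index (m ↑ʳ b) ≡ b
  side-index-↑ʳ b rewrite splitAt-↑ʳ m m b = refl

  endL endR : Fin L → Fin m
  endL e = side-index (src e)
  endR e = side-index (tgt e)

  leftV rightV : Fin m → Vertex S
  leftV a = orig (a ↑ˡ m)
  rightV b = orig (m ↑ʳ b)

  pair : Fin m → Fin m → Fin (m + m) × Fin (m + m)
  pair a b = a ↑ˡ m , m ↑ʳ b

  row : Fin m → List (Fin (m + m) × Fin (m + m))
  row a = map (pair a) (allFin m)

  Kmm-edge⁺ : ∀ a b → pair a b ∈ E
  Kmm-edge⁺ a b = ∈-concatMap⁺ row (lose (∈-allFin a) (∈-map⁺ (pair a) (∈-allFin b)))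

  Kmm-edge⁻ : ∀ {x} → x ∈ E → ∃₂ λ a b → x ≡ pair a b
  Kmm-edge⁻ x∈ with Any.satisfied (∈-concatMap⁻ row {xs = allFin m} x∈)
  ... | a , x∈row with ∈-map⁻ (pair a) x∈row
  ...   | b , _ , x≡ = a , b , x≡

  edge-shape : ∀ e → lookup E e ≡ pair (endL e) (endR e)
  edge-shape e with Kmm-edge⁻ (∈-lookup e)
  ... | a , b , e≡ = trans e≡ (cong₂ pair (sym endL≡) (sym endR≡))
    where
    endL≡ : endL e ≡ a
    endL≡ = trans (cong (side-index ∘ proj₁) e≡) (side-index-↑ˡ a)
    endR≡ : endR e ≡ b
    endR≡ = trans (cong (side-index ∘ proj₂) e≡) (side-index-↑ʳ b)

  src≡ : ∀ e → orig (src e) ≡ leftV (endL e)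
  src≡ e = cong (orig ∘ proj₁) (edge-shape e)

  tgt≡ : ∀ e → orig (tgt e) ≡ rightV (endR e)
  tgt≡ e = cong (orig ∘ proj₂) (edge-shape e)

  edgeOf : Fin m → Fin m → Fin L
  edgeOf a b = Any.index (Kmm-edge⁺ a b)

  endL-edgeOf : ∀ a b → endL (edgeOf a b) ≡ a
  endL-edgeOf a b = trans (cong (side-index ∘ proj₁) (sym (lookup-index (Kmm-edge⁺ a b)))) (side-index-↑ˡ a)

  endR-edgeOf : ∀ a b → endR (edgeOf a b) ≡ b
  endR-edgeOf a b = trans (cong (side-index ∘ proj₂) (sym (lookup-index (Kmm-edge⁺ a b)))) (side-index-↑ʳ b)

  ∑-edges : ∀ (f : Fin m → Fin m → ℕ) → ∑[ e < L ] f (endL e) (endR e) ≡ ∑[ a < m ] ∑[ b < m ] f a b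
  ∑-edges f = begin
    ∑[ e < L ] g (lookup E e)                      ≡⟨ ∑-lookup g E ⟩
    sum (map g E)                                  ≡⟨ sum-map-concatMap g row (allFin m) ⟩
    sum (map (sum ∘ map g ∘ row) (allFin m))       ≡⟨ sum-map-allFin m (sum ∘ map g ∘ row) ⟩
    ∑[ a < m ] sum (map g (row a))                 ≡⟨ sum-cong-≗ (λ a → trans (cong sum (sym (map-∘ {g = g} {f = pair a} (allFin m)))) (sum-map-allFin m (g ∘ pair a))) ⟩
    ∑[ a < m ] ∑[ b < m ] g (pair a b)             ≡⟨ sum-cong-≗ (λ a → sum-cong-≗ (λ b → cong₂ f (side-index-↑ˡ a) (side-index-↑ʳ b))) ⟩
    ∑[ a < m ] ∑[ b < m ] f a b                    ∎
    where
    open ≡-Reasoning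
    g : Fin (m + m) × Fin (m + m) → ℕ
    g (u , v) = f (side-index u) (side-index v)

  left~mid : ∀ e → Adjacent S (leftV (endL e)) (mid e)
  left~mid e = inj₁ (subst (λ x → (x , mid e) ∈ edges S) (src≡ e) (src-half∈ e))

  right~mid : ∀ e → Adjacent S (rightV (endR e)) (mid e)
  right~mid e = inj₁ (subst (λ x → (x , mid e) ∈ edges S) (tgt≡ e) (tgt-half∈ e))

  left⇝right : ∀ a b → Walk S 2 (leftV a) (rightV b)
  left⇝right a b = subst₂ (λ a′ b′ → Walk S 2 (leftV a′) (rightV b′)) (endL-edgeOf a b) (endR-edgeOf a b)
    (left~mid e ∷ Adjacent-sym (right~mid e) ∷ [])
    where
    e : Fin L
    e = edgeOf a b

  right⇝left : ∀ b a → Walk S 2 (rightV b) (leftV a)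
  right⇝left b a = subst₂ (λ b′ a′ → Walk S 2 (rightV b′) (leftV a′)) (endR-edgeOf a b) (endL-edgeOf a b)
    (right~mid e ∷ Adjacent-sym (left~mid e) ∷ [])
    where
    e : Fin L
    e = edgeOf a b

  data View : Vertex S → Set where
    at-left  : ∀ a → View (leftV a)
    at-right : ∀ b → View (rightV b)
    at-mid   : ∀ e → View (mid e)

  view : ∀ v → View v
  view v with splitAt (m + m) v in eq
  ... | inj₂ e = subst View (splitAt⁻¹-↑ʳ eq) (at-mid e)
  ... | inj₁ i with splitAt m i in eq′
  ...   | inj₁ a = subst View (trans (cong (_↑ˡ L) (splitAt⁻¹-↑ˡ eq′)) (splitAt⁻¹-↑ˡ eq)) (at-left a)
  ...   | inj₂ b = subst View (trans (cong (_↑ˡ L) (splitAt⁻¹-↑ʳ eq′)) (splitAt⁻¹-↑ˡ eq)) (at-right b)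

  vertexCase : (Fin m → ℕ) → (Fin m → ℕ) → (Fin L → ℕ) → Vertex S → ℕ
  vertexCase f g h v = [ [ f , g ]′ ∘ splitAt m , h ]′ (splitAt (m + m) v)

  module _ {f g : Fin m → ℕ} {h : Fin L → ℕ} where

    vertexCase-left : ∀ a → vertexCase f g h (leftV a) ≡ f a
    vertexCase-left a rewrite splitAt-↑ˡ (m + m) (a ↑ˡ m) L | splitAt-↑ˡ m a m = refl

    vertexCase-right : ∀ b → vertexCase f g h (rightV b) ≡ g b
    vertexCase-right b rewrite splitAt-↑ˡ (m + m) (m ↑ʳ b) L | splitAt-↑ʳ m m b = refl

    vertexCase-mid : ∀ e → vertexCase f g h (mid e) ≡ h e
    vertexCase-mid e rewrite splitAt-↑ʳ (m + m) L e = refl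

    vertexCase-≤ : ∀ {c} → (∀ a → f a ≤ c) → (∀ b → g b ≤ c) → (∀ e → h e ≤ c) → ∀ v → vertexCase f g h v ≤ c
    vertexCase-≤ f≤ g≤ h≤ v with splitAt (m + m) v
    ... | inj₂ e = h≤ e
    ... | inj₁ i with splitAt m i
    ...   | inj₁ a = f≤ a
    ...   | inj₂ b = g≤ b

  place : Place → Fin L → Vertex S
  place leftEnd  e = leftV (endL e)
  place rightEnd e = rightV (endR e)
  place middle   e = mid e

  δ : Place → Fin L → Vertex S → ℕ
  δ p e₀ = vertexCase (λ a → δ-left p (a == endL e₀)) (λ b → δ-right p (b == endR e₀))
                      (λ e → δ-mid p (e == e₀) (endL e == endL e₀) (endR e == endR e₀))

  δ-source : ∀ p e₀ → δ p e₀ (place p e₀) ≡ 0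
  δ-source leftEnd  e₀ = trans (vertexCase-left (endL e₀)) (cong (δ-left leftEnd) (==-refl (endL e₀)))
  δ-source rightEnd e₀ = trans (vertexCase-right (endR e₀)) (cong (δ-right rightEnd) (==-refl (endR e₀)))
  δ-source middle   e₀ = trans (vertexCase-mid e₀) (cong (λ τ → δ-mid middle τ (endL e₀ == endL e₀) (endR e₀ == endR e₀)) (==-refl e₀))

  module _ (p : Place) (e₀ : Fin L) where

    δ-src : ∀ e → δ p e₀ (orig (src e)) ≡ δ-left p (endL e == endL e₀)
    δ-src e = trans (cong (δ p e₀) (src≡ e)) (vertexCase-left (endL e))

    δ-tgt : ∀ e → δ p e₀ (orig (tgt e)) ≡ δ-right p (endR e == endR e₀)
    δ-tgt e = trans (cong (δ p e₀) (tgt≡ e)) (vertexCase-right (endR e))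

    δ-mid-at : ∀ e → δ p e₀ (mid e) ≡ δ-mid p (e == e₀) (endL e == endL e₀) (endR e == endR e₀)
    δ-mid-at e = vertexCase-mid e

    δ-≤4 : ∀ v → δ p e₀ v ≤ 4
    δ-≤4 = vertexCase-≤ (λ _ → δ-left≤4 p _) (λ _ → δ-right≤4 p _) (λ _ → δ-mid≤4 p _ _ _)

    δ-Lipschitz : Lipschitz S (δ p e₀)
    δ-Lipschitz = Lipschitz-subdivision close
      where
      same-ends : ∀ e → T (e == e₀) → T ((endL e == endL e₀) ∧ (endR e == endR e₀))
      same-ends e t with e ≟ᶠ e₀
      ... | yes refl rewrite ==-refl (endL e) | ==-refl (endR e) = _
      ... | no _ = ⊥-elim t
      close : ∀ e → Close (δ p e₀ (orig (src e))) (δ p e₀ (mid e)) × Close (δ p e₀ (orig (tgt e))) (δ p e₀ (mid e))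
      close e rewrite δ-src e | δ-tgt e | δ-mid-at e = δ-close p (e == e₀) _ _ (same-ends e)

  walk-to-left : ∀ p e₀ a → Walk S (δ-left p (a == endL e₀)) (place p e₀) (leftV a)
  walk-to-left leftEnd e₀ a with a ≟ᶠ endL e₀
  ... | yes refl = []
  ... | no _     = left⇝right (endL e₀) Fin.zero ++ʷ right⇝left Fin.zero a
  walk-to-left rightEnd e₀ a = right⇝left (endR e₀) a
  walk-to-left middle e₀ a with a ≟ᶠ endL e₀
  ... | yes refl = Adjacent-sym (left~mid e₀) ∷ []
  ... | no _     = Adjacent-sym (right~mid e₀) ∷ right⇝left (endR e₀) a

  walk-to-right : ∀ p e₀ b → Walk S (δ-right p (b == endR e₀)) (place p e₀) (rightV b)
  walk-to-right leftEnd e₀ b = left⇝right (endL e₀) b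
  walk-to-right rightEnd e₀ b with b ≟ᶠ endR e₀
  ... | yes refl = []
  ... | no _     = right⇝left (endR e₀) Fin.zero ++ʷ left⇝right Fin.zero b
  walk-to-right middle e₀ b with b ≟ᶠ endR e₀
  ... | yes refl = Adjacent-sym (right~mid e₀) ∷ []
  ... | no _     = Adjacent-sym (left~mid e₀) ∷ left⇝right (endL e₀) b

  walk-to-mid : ∀ p e₀ e → Walk S (δ-mid p (e == e₀) (endL e == endL e₀) (endR e == endR e₀)) (place p e₀) (mid e)
  walk-to-mid leftEnd e₀ e with endL e ≟ᶠ endL e₀
  ... | yes eq = subst (λ a → Adjacent S (leftV a) (mid e)) eq (left~mid e) ∷ []
  ... | no _   = left⇝right (endL e₀) (endR e) ++ʷ right~mid e ∷ []
  walk-to-mid rightEnd e₀ e with endR e ≟ᶠ endR e₀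
  ... | yes eq = subst (λ b → Adjacent S (rightV b) (mid e)) eq (right~mid e) ∷ []
  ... | no _   = right⇝left (endR e₀) (endL e) ++ʷ left~mid e ∷ []
  walk-to-mid middle e₀ e with e ≟ᶠ e₀
  ... | yes refl = []
  ... | no _ with endL e ≟ᶠ endL e₀
  ...   | yes eq = Adjacent-sym (left~mid e₀) ∷ subst (λ a → Adjacent S (leftV a) (mid e)) eq (left~mid e) ∷ []
  ...   | no _ with endR e ≟ᶠ endR e₀
  ...     | yes eq = Adjacent-sym (right~mid e₀) ∷ subst (λ b → Adjacent S (rightV b) (mid e)) eq (right~mid e) ∷ []
  ...     | no _   = Adjacent-sym (left~mid e₀) ∷ left⇝right (endL e₀) (endR e) ++ʷ right~mid e ∷ []

  δ-walk : ∀ p e₀ v → Walk S (δ p e₀ v) (place p e₀) v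
  δ-walk p e₀ v with view v
  ... | at-left a  = subst (λ d → Walk S d (place p e₀) (leftV a)) (sym (vertexCase-left a)) (walk-to-left p e₀ a)
  ... | at-right b = subst (λ d → Walk S d (place p e₀) (rightV b)) (sym (vertexCase-right b)) (walk-to-right p e₀ b)
  ... | at-mid e   = subst (λ d → Walk S d (place p e₀) (mid e)) (sym (δ-mid-at p e₀ e)) (walk-to-mid p e₀ e)

  4≤nS : 4 ≤ n S
  4≤nS = m≤n⇒m≤n+o L (+-mono-≤ (m≤m+n 2 k) (m≤m+n 2 k))

  dist-place : ∀ p e₀ v → dist S (place p e₀) v ≡ δ p e₀ v
  dist-place p e₀ v =
    dist-from-potential S (δ-Lipschitz p e₀) (δ-source p e₀) (≤-trans (δ-≤4 p e₀ v) 4≤nS) (δ-walk p e₀ v)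

  dist-path : ∀ p e₀ e →
    (dist S (place p e₀) (orig (src e)) , dist S (place p e₀) (orig (tgt e)) , dist S (place p e₀) (mid e))
    ≡ δ-path p (e == e₀) (endL e == endL e₀) (endR e == endR e₀)
  dist-path p e₀ e = cong₂ _,_ (trans (dist-place p e₀ _) (δ-src p e₀ e))
                    (cong₂ _,_ (trans (dist-place p e₀ _) (δ-tgt p e₀ e)) (trans (dist-place p e₀ _) (δ-mid-at p e₀ e)))

  module _ (p q : Place) (e₀ : Fin L) where

    private
      c : Bool → Bool → Bool → ℕ
      c = δ-closerHalves p q
      α β : Fin L → Bool
      α e = endL e == endL e₀
      β e = endR e == endR e₀

    -- The constants sit on the left of +, so that comparing such sums never evaluates mcount.
    mcount-places : δ-closerHalves p q false true true + mcount S (place p e₀) (place q e₀) ≡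
                    δ-closerHalves p q true true true + gridSum (suc k) (δ-closerHalves p q false)
    mcount-places = begin
      c false true true + mcount S (place p e₀) (place q e₀)
        ≡⟨ cong₂ _+_ (sym (cong₂ (c false) (==-refl (endL e₀)) (==-refl (endR e₀))))
                     (trans (mcount-subdivision (place p e₀) (place q e₀))
                            (sum-cong-≗ (λ e → cong₂ closerHalves (dist-path p e₀ e) (dist-path q e₀ e)))) ⟩
      c false (α e₀) (β e₀) + ∑[ e < L ] c (e == e₀) (α e) (β e)
        ≡⟨ ∑-unflag (λ e τ → c τ (α e) (β e)) e₀ ⟩
      c true (α e₀) (β e₀) + ∑[ e < L ] c false (α e) (β e)
        ≡⟨ cong₂ _+_ (cong₂ (c true) (==-refl (endL e₀)) (==-refl (endR e₀)))
                     (∑-edges (λ a b → c false (a == endL e₀) (b == endR e₀))) ⟩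
      c true true true + ∑[ a < m ] ∑[ b < m ] c false (a == endL e₀) (b == endR e₀)
        ≡⟨ cong (_+_ (c true true true)) (∑-grid (c false) (endL e₀) (endR e₀)) ⟩
      c true true true + gridSum (suc k) (c false) ∎
      where open ≡-Reasoning

  data PlacedHalf : Vertex S → Vertex S → Set where
    left-half  : ∀ e → PlacedHalf (place leftEnd e) (place middle e)
    right-half : ∀ e → PlacedHalf (place rightEnd e) (place middle e)

  placed-half : ∀ {x y} → (x , y) ∈ edges S → PlacedHalf x y
  placed-half xy∈ with half xy∈
  ... | src-half e = subst (λ x → PlacedHalf x (mid e)) (sym (src≡ e)) (left-half e)
  ... | tgt-half e = subst (λ x → PlacedHalf x (mid e)) (sym (tgt≡ e)) (right-half e)

  half-counts : ∀ {x y} → PlacedHalf x y → mcount S x y ≡ m * m ∸ 1 × mcount S y x ≡ suc (2 * m ∸ 2)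
  half-counts (left-half e) =
      suc-injective (trans (mcount-places leftEnd middle e) (square₁ k))
    , trans (mcount-places middle leftEnd e) (double₁ k)
    where
    square₁ : ∀ k → 0 + ((1 + suc k * 2) + suc k * (0 + suc k * 1)) ≡ suc (suc k + suc k * (2 + k))
    square₁ = solve-∀
    double₁ : ∀ k → 1 + ((0 + suc k * 0) + suc k * (2 + suc k * 0)) ≡ suc (k + suc (suc (k + 0)))
    double₁ = solve-∀
  half-counts (right-half e) =
      suc-injective (trans (mcount-places rightEnd middle e) (square₂ k))
    , trans (mcount-places middle rightEnd e) (double₂ k)
    where
    square₂ : ∀ k → 0 + ((1 + suc k * 0) + suc k * (2 + suc k * 1)) ≡ suc (suc k + suc k * (2 + k))
    square₂ = solve-∀
    double₂ : ∀ k → 1 + ((0 + suc k * 2) + suc k * (0 + suc k * 0)) ≡ suc (k + suc (suc (k + 0)))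
    double₂ = solve-∀

2m-1<m²-1 : ∀ j → suc (2 * (3 + j) ∸ 2) ℕ.< (3 + j) * (3 + j) ∸ 1
2m-1<m²-1 j = s≤s (s≤s (subst (2m ≤_) (expand j) (m≤m+n 2m (j * j + 4 * j + 2))))
  where
  2m : ℕ
  2m = suc (j + suc (suc (suc (j + 0))))
  expand : ∀ j → suc (j + suc (suc (suc (j + 0)))) + (j * j + 4 * j + 2) ≡ j + suc (suc j) * suc (suc (suc j))
  expand = solve-∀

proposition4p2 : (m : ℕ) → m ≥ 3 → (λ' : ℚ) → 1ℚ < λ' →
    (IsEQDB λ' (subdivision (Kmm m)) ⇔ (λ' ≡ (+ (m * m ∸ 1)) / suc (2 * m ∸ 2)))
proposition4p2 (suc (suc (suc j))) (s≤s (s≤s (s≤s _))) λ' 1<λ =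
  IsEQDB⇔ratio S (m * m ∸ 1) (2 * m ∸ 2) (λ gh∈ → half-counts (placed-half gh∈))
               (src-half∈ (edgeOf Fin.zero Fin.zero)) (2m-1<m²-1 j) 1<λ
  where open SubdividedKmm (suc j)
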